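{- If $B\subset\mathcal{S}_n$ is $(1,1)$-guaranteed, then $B$ is $(r,r)$-guaranteed for every integer $r\ge1$.
   Context: $\Sigma$ is a finite alphabet with $|\Sigma|>1$, $n\ge1$, $\mathcal{S}_n=\Sigma^n$ with the edit (Levenshtein) distance $\mathrm{edit}$. $N_n^r(s)=\{t\in\mathcal{S}_n:\mathrm{edit}(s,t)\le r\}$. A subset $B\subset\mathcal{S}_n$ is $(d_1,r)$-guaranteed if $N_n^r(s)\cap N_n^r(t)\cap B\neq\emptyset$ for every pair $s,t\in\mathcal{S}_n$ with $\mathrm{edit}(s,t)\le d_1$. -}

module Defs where

open import Data.Nat using (ℕ; zero; suc; _+_; _≤_; _⊓_)
open import Data.Fin using (Fin)
open import Data.Fin.Properties using (_≟_)
open import Data.List using (List; []; _∷_; length)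
open import Data.Vec using (Vec; toList)
open import Data.Product using (_×_; ∃)
open import Relation.Nullary using (yes; no)

-- Alphabet Σ = Fin q (a finite alphabet; |Σ| > 1 is imposed as q ≥ 2 in the statement).

subCost : ∀ {q} → Fin q → Fin q → ℕ
subCost x y with x ≟ y
... | yes _ = 0
... | no  _ = 1

lev : ∀ {q} → List (Fin q) → List (Fin q) → ℕ
lev [] ys = length ys
lev (x ∷ xs) [] = suc (length xs)
lev (x ∷ xs) (y ∷ ys) =
  suc (lev xs (y ∷ ys)) ⊓ (suc (lev (x ∷ xs) ys) ⊓ (lev xs ys + subCost x y))

Word : ℕ → ℕ → Set
Word q n = Vec (Fin q) n

edit : ∀ {q n} → Word q n → Word q n → ℕ
edit s t = lev (toList s) (toList t)

InBall : ∀ {q n} → ℕ → Word q n → Word q n → Set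
InBall r s u = edit s u ≤ r

Guaranteed : ∀ {q n} → ℕ → ℕ → (Word q n → Set) → Set
Guaranteed {q} {n} d₁ r B =
  (s t : Word q n) → edit s t ≤ d₁ →
  ∃ λ (u : Word q n) → InBall r s u × InBall r t u × B u

{-# OPTIONS --safe #-}
-- Let s, t be words of length n with edit(s, t) = d ≥ 1. Since the lengths agree,
-- an optimal alignment of t against s cannot consist of matches and deletions only,
-- so it substitutes or inserts some symbol t_i; replacing t_i by any symbol then
-- costs nothing. Let t' differ from t exactly at position i and let u ∈ B be within
-- distance 1 of t and t'. Equal-length words at edit distance ≤ 1 are at Hamming
-- distance ≤ 1, so u agrees with t outside position i; hence edit(s, u) ≤ d and
-- edit(t, u) ≤ 1 ≤ d.
module Submission where

open import Defs
open import Data.Nat using (ℕ; zero; suc; _+_; _⊓_; _<_; _≤_; z≤n; s≤s)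
open import Data.Nat.Properties hiding (_≟_)
open import Data.Fin using (Fin)
import Data.Fin as Fin
open import Data.Fin.Properties using (_≟_)
open import Data.List using (List; []; _∷_; length)
open import Data.List.Properties using (∷-injectiveˡ; ∷-injectiveʳ)
open import Data.Vec using (Vec; toList)
import Data.Vec as Vec
open import Data.Vec.Properties using (length-toList)
open import Data.Product using (_×_; ∃; _,_)
open import Data.Sum using (inj₁; inj₂)
open import Data.Empty using (⊥-elim)
open import Relation.Nullary using (Dec; yes; no)
open import Relation.Binary.PropositionalEquality
open import Function using (_∘_)

-- Positions are plain naturals, so that updates transfer between lists and vectors;
-- an out-of-range update is the identity.
update : ∀ {A : Set} → List A → ℕ → A → List A
update []       i       c = []
update (x ∷ xs) zero    c = c ∷ xs
update (x ∷ xs) (suc i) c = x ∷ update xs i c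

length-update : ∀ {A : Set} (xs : List A) i c → length (update xs i c) ≡ length xs
length-update []       i       c = refl
length-update (x ∷ xs) zero    c = refl
length-update (x ∷ xs) (suc i) c = cong suc (length-update xs i c)

updateᵛ : ∀ {A : Set} {n} → Vec A n → ℕ → A → Vec A n
updateᵛ Vec.[]       i       c = Vec.[]
updateᵛ (x Vec.∷ xs) zero    c = c Vec.∷ xs
updateᵛ (x Vec.∷ xs) (suc i) c = x Vec.∷ updateᵛ xs i c

toList-updateᵛ : ∀ {A : Set} {n} (v : Vec A n) i c → toList (updateᵛ v i c) ≡ update (toList v) i c
toList-updateᵛ Vec.[]       i       c = refl
toList-updateᵛ (x Vec.∷ xs) zero    c = refl
toList-updateᵛ (x Vec.∷ xs) (suc i) c = cong (x ∷_) (toList-updateᵛ xs i c)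

length-toList-≡ : ∀ {A : Set} {n} (v w : Vec A n) → length (toList v) ≡ length (toList w)
length-toList-≡ v w = trans (length-toList v) (sym (length-toList w))

module _ {q : ℕ} where

  Str : Set
  Str = List (Fin q)

  ∃-update-≢ : {a b : Fin q} → a ≢ b → (xs : Str) (i : ℕ) → i < length xs →
               ∃ λ c → update xs i c ≢ xs
  ∃-update-≢ {a} {b} a≢b (x ∷ xs) zero _ with x ≟ a
  ... | yes refl = b , λ e → a≢b (sym (∷-injectiveˡ e))
  ... | no  x≢a  = a , λ e → x≢a (sym (∷-injectiveˡ e))
  ∃-update-≢ a≢b (x ∷ xs) (suc i) (s≤s i<) with ∃-update-≢ a≢b xs i i<
  ... | c , ≢xs = c , λ e → ≢xs (∷-injectiveʳ e)

  subCost-refl : (x : Fin q) → subCost x x ≡ 0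
  subCost-refl x with x ≟ x
  ... | yes _   = refl
  ... | no  x≢x = ⊥-elim (x≢x refl)

  subCost-≢ : {x y : Fin q} → x ≢ y → subCost x y ≡ 1
  subCost-≢ {x} {y} x≢y with x ≟ y
  ... | yes x≡y = ⊥-elim (x≢y x≡y)
  ... | no  _   = refl

  subCost≤1 : (x y : Fin q) → subCost x y ≤ 1
  subCost≤1 x y with x ≟ y
  ... | yes _ = z≤n
  ... | no  _ = s≤s z≤n

  subCost≡0⇒≡ : {x y : Fin q} → subCost x y ≡ 0 → x ≡ y
  subCost≡0⇒≡ {x} {y} e with x ≟ y
  ... | yes x≡y = x≡y
  subCost≡0⇒≡ () | no _

  lev-[]ʳ : (xs : Str) → lev xs [] ≡ length xs
  lev-[]ʳ []       = refl
  lev-[]ʳ (x ∷ xs) = refl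

  lev≤del : ∀ (x : Fin q) xs y ys → lev (x ∷ xs) (y ∷ ys) ≤ suc (lev xs (y ∷ ys))
  lev≤del x xs y ys = m⊓n≤m _ _

  lev≤ins : ∀ (x : Fin q) xs y ys → lev (x ∷ xs) (y ∷ ys) ≤ suc (lev (x ∷ xs) ys)
  lev≤ins x xs y ys = ≤-trans (m⊓n≤n _ _) (m⊓n≤m _ _)

  lev≤sub : ∀ (x : Fin q) xs y ys → lev (x ∷ xs) (y ∷ ys) ≤ lev xs ys + subCost x y
  lev≤sub x xs y ys = ≤-trans (m⊓n≤n _ _) (m⊓n≤n _ _)

  lev-∷ˡ : ∀ x (xs zs : Str) → lev (x ∷ xs) zs ≤ suc (lev xs zs)
  lev-∷ˡ x xs []       = ≤-reflexive (cong suc (sym (lev-[]ʳ xs)))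
  lev-∷ˡ x xs (z ∷ zs) = lev≤del x xs z zs

  lev-∷-∷ : ∀ x (xs ys : Str) → lev (x ∷ xs) (x ∷ ys) ≤ lev xs ys
  lev-∷-∷ x xs ys = ≤-trans (lev≤sub x xs x ys)
    (≤-reflexive (trans (cong (lev xs ys +_) (subCost-refl x)) (+-identityʳ _)))

  lev-refl : (xs : Str) → lev xs xs ≡ 0
  lev-refl []       = refl
  lev-refl (x ∷ xs) = n≤0⇒n≡0 (≤-trans (lev-∷-∷ x xs xs) (≤-reflexive (lev-refl xs)))

  lev-update≤1 : ∀ (xs : Str) i c → lev xs (update xs i c) ≤ 1
  lev-update≤1 []       i       c = z≤n
  lev-update≤1 (x ∷ xs) zero    c = ≤-trans (lev≤sub x xs c xs)
    (subst (λ k → k + subCost x c ≤ 1) (sym (lev-refl xs)) (subCost≤1 x c))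
  lev-update≤1 (x ∷ xs) (suc i) c =
    ≤-trans (lev-∷-∷ x xs (update xs i c)) (lev-update≤1 xs i c)

  data LevCase (x : Fin q) (xs : Str) (y : Fin q) (ys : Str) : Set where
    del   : lev (x ∷ xs) (y ∷ ys) ≡ suc (lev xs (y ∷ ys)) → LevCase x xs y ys
    ins   : lev (x ∷ xs) (y ∷ ys) ≡ suc (lev (x ∷ xs) ys) → LevCase x xs y ys
    match : x ≡ y → lev (x ∷ xs) (y ∷ ys) ≡ lev xs ys → LevCase x xs y ys
    sub   : x ≢ y → lev (x ∷ xs) (y ∷ ys) ≡ suc (lev xs ys) → LevCase x xs y ys

  levCase-diag : ∀ {x xs y ys} → Dec (x ≡ y) →
                 lev (x ∷ xs) (y ∷ ys) ≡ lev xs ys + subCost x y → LevCase x xs y ys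
  levCase-diag {x} {xs} {ys = ys} (yes refl) e =
    match refl (trans e (trans (cong (lev xs ys +_) (subCost-refl x)) (+-identityʳ _)))
  levCase-diag {xs = xs} {ys = ys} (no x≢y) e =
    sub x≢y (trans e (trans (cong (lev xs ys +_) (subCost-≢ x≢y)) (+-comm _ 1)))

  levCase : ∀ x xs y ys → LevCase x xs y ys
  levCase x xs y ys
    with ⊓-sel (suc (lev xs (y ∷ ys))) (suc (lev (x ∷ xs) ys) ⊓ (lev xs ys + subCost x y))
  ... | inj₁ e = del e
  ... | inj₂ e with ⊓-sel (suc (lev (x ∷ xs) ys)) (lev xs ys + subCost x y)
  ...   | inj₁ e′ = ins (trans e e′)
  ...   | inj₂ e′ = levCase-diag (x ≟ y) (trans e e′)

  lev≡0⇒≡ : ∀ (xs ys : Str) → lev xs ys ≡ 0 → xs ≡ ys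
  lev≡0⇒≡ []       []       _ = refl
  lev≡0⇒≡ (x ∷ xs) (y ∷ ys) h with levCase x xs y ys
  ... | del e        = ⊥-elim (1+n≢0 (trans (sym e) h))
  ... | ins e        = ⊥-elim (1+n≢0 (trans (sym e) h))
  ... | sub _ e      = ⊥-elim (1+n≢0 (trans (sym e) h))
  ... | match refl e = cong (x ∷_) (lev≡0⇒≡ xs ys (trans (sym e) h))

  Replaceable : Str → Str → ℕ → Set
  Replaceable xs ys i = ∀ c → lev xs (update ys i c) ≤ lev xs ys

  replaceable-position : ∀ (xs ys : Str) → length xs < lev xs ys + length ys →
                         ∃ λ i → i < length ys × Replaceable xs ys i
  replaceable-position []       (y ∷ ys) _ = 0 , s≤s z≤n , λ c → ≤-refl
  replaceable-position (x ∷ xs) []       h = ⊥-elim (<-irrefl (sym (+-identityʳ _)) h)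
  replaceable-position (x ∷ xs) (y ∷ ys) h with levCase x xs y ys
  ... | ins e   = 0 , s≤s z≤n , λ c → ≤-trans (lev≤ins x xs c ys) (≤-reflexive (sym e))
  ... | sub x≢y e = 0 , s≤s z≤n , λ c → begin
          lev (x ∷ xs) (c ∷ ys)   ≤⟨ lev≤sub x xs c ys ⟩
          lev xs ys + subCost x c ≤⟨ +-monoʳ-≤ (lev xs ys) (subCost≤1 x c) ⟩
          lev xs ys + 1           ≡⟨ +-comm (lev xs ys) 1 ⟩
          suc (lev xs ys)         ≡⟨ e ⟨
          lev (x ∷ xs) (y ∷ ys)   ∎
    where open ≤-Reasoning
  ... | del e with replaceable-position xs (y ∷ ys)
                     (≤-pred (subst (λ k → suc (length xs) < k + suc (length ys)) e h))
  ...   | i , i< , r = i , i< , λ c → begin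
          lev (x ∷ xs) (update (y ∷ ys) i c) ≤⟨ lev-∷ˡ x xs (update (y ∷ ys) i c) ⟩
          suc (lev xs (update (y ∷ ys) i c)) ≤⟨ s≤s (r c) ⟩
          suc (lev xs (y ∷ ys))              ≡⟨ e ⟨
          lev (x ∷ xs) (y ∷ ys)              ∎
    where open ≤-Reasoning
  replaceable-position (x ∷ xs) (x ∷ ys) h | match refl e
    with replaceable-position xs ys (≤-pred (subst (suc (length xs) <_) (+-suc _ _)
           (subst (λ k → suc (length xs) < k + suc (length ys)) e h)))
  ... | i , i< , r = suc i , s≤s i< , λ c → begin
          lev (x ∷ xs) (x ∷ update ys i c) ≤⟨ lev-∷-∷ x xs (update ys i c) ⟩
          lev xs (update ys i c)           ≤⟨ r c ⟩
          lev xs ys                        ≡⟨ e ⟨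
          lev (x ∷ xs) (x ∷ ys)            ∎
    where open ≤-Reasoning

  length-<-lev+length : ∀ (xs ys : Str) → length xs ≡ length ys → 1 ≤ lev xs ys →
                        length xs < lev xs ys + length ys
  length-<-lev+length xs ys len 1≤d =
    subst (_< lev xs ys + length ys) (sym len) (+-monoˡ-≤ (length ys) 1≤d)

  hamming : Str → Str → ℕ
  hamming (x ∷ xs) (y ∷ ys) = subCost x y + hamming xs ys
  hamming _        _        = 0

  hamming-∷-∷ : ∀ x (xs ys : Str) → hamming (x ∷ xs) (x ∷ ys) ≡ hamming xs ys
  hamming-∷-∷ x xs ys = cong (_+ hamming xs ys) (subCost-refl x)

  hamming-refl : (xs : Str) → hamming xs xs ≡ 0
  hamming-refl []       = refl
  hamming-refl (x ∷ xs) = trans (hamming-∷-∷ x xs xs) (hamming-refl xs)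

  hamming≡0⇒≡ : ∀ (xs ys : Str) → length xs ≡ length ys → hamming xs ys ≡ 0 → xs ≡ ys
  hamming≡0⇒≡ []       []       _   _ = refl
  hamming≡0⇒≡ (x ∷ xs) (y ∷ ys) len h =
    cong₂ _∷_ (subCost≡0⇒≡ (m+n≡0⇒m≡0 (subCost x y) h))
              (hamming≡0⇒≡ xs ys (suc-injective len) (m+n≡0⇒n≡0 (subCost x y) h))

  lev≤1⇒hamming≤1 : ∀ (xs ys : Str) → length xs ≡ length ys → lev xs ys ≤ 1 → hamming xs ys ≤ 1
  lev≤1⇒hamming≤1 []       []       _   _ = z≤n
  lev≤1⇒hamming≤1 (x ∷ xs) (y ∷ ys) len h with levCase x xs y ys
  ... | del e = ⊥-elim (1+n≢n (trans (sym (cong length xs≡y∷ys)) (suc-injective len)))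
    where xs≡y∷ys = lev≡0⇒≡ xs (y ∷ ys) (n<1⇒n≡0 (subst (_≤ 1) e h))
  ... | ins e = ⊥-elim (1+n≢n (trans (cong length x∷xs≡ys) (sym (suc-injective len))))
    where x∷xs≡ys = lev≡0⇒≡ (x ∷ xs) ys (n<1⇒n≡0 (subst (_≤ 1) e h))
  ... | match refl e = subst (_≤ 1) (sym (hamming-∷-∷ x xs ys))
                         (lev≤1⇒hamming≤1 xs ys (suc-injective len) (subst (_≤ 1) e h))
  ... | sub x≢y e = ≤-reflexive (cong₂ _+_ (subCost-≢ x≢y)
                      (trans (cong (hamming xs) (sym xs≡ys)) (hamming-refl xs)))
    where xs≡ys = lev≡0⇒≡ xs ys (n<1⇒n≡0 (subst (_≤ 1) e h))

  hamming≤1-∩⇒update : ∀ (xs us : Str) i c′ → length xs ≡ length us →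
                       hamming xs us ≤ 1 → hamming (update xs i c′) us ≤ 1 →
                       update xs i c′ ≢ xs → ∃ λ c → us ≡ update xs i c
  hamming≤1-∩⇒update []       us       i       c′ _   _ _  ≢xs = ⊥-elim (≢xs refl)
  hamming≤1-∩⇒update (x ∷ xs) (u ∷ us) zero    c′ len h h′ ≢xs with hamming xs us in eq
  ... | zero  = u , cong (u ∷_) (sym (hamming≡0⇒≡ xs us (suc-injective len) eq))
  ... | suc k = ⊥-elim (≢xs (cong (_∷ xs) (trans (heads≡ h′) (sym (heads≡ h)))))
    where
    heads≡ : ∀ {a b : Fin q} → subCost a b + suc k ≤ 1 → a ≡ b
    heads≡ {a} {b} h = subCost≡0⇒≡ (m+n≡0⇒m≡0 (subCost a b)
                         (n<1⇒n≡0 (subst (_≤ 1) (+-suc (subCost a b) k) h)))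
  -- Matching on x ≟ u reduces the head costs subCost x u in h and h′ to 0 resp. 1.
  hamming≤1-∩⇒update (x ∷ xs) (u ∷ us) (suc i) c′ len h h′ ≢xs with x ≟ u
  ... | yes refl with hamming≤1-∩⇒update xs us i c′ (suc-injective len) h h′ (≢xs ∘ cong (x ∷_))
  ...   | c , e = c , cong (x ∷_) e
  hamming≤1-∩⇒update (x ∷ xs) (u ∷ us) (suc i) c′ len h h′ ≢xs | no _ =
    ⊥-elim (≢xs (cong (x ∷_) (trans
      (hamming≡0⇒≡ (update xs i c′) us (trans (length-update xs i c′) (suc-injective len)) (n<1⇒n≡0 h′))
      (sym (hamming≡0⇒≡ xs us (suc-injective len) (n<1⇒n≡0 h))))))

edit-updateᵛ≤1 : ∀ {q n} (t : Word q n) i c → edit t (updateᵛ t i c) ≤ 1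
edit-updateᵛ≤1 t i c =
  subst (λ z → lev (toList t) z ≤ 1) (sym (toList-updateᵛ t i c)) (lev-update≤1 (toList t) i c)

guaranteed-1-1-step : ∀ {q n} {B : Word q n → Set} (a b : Fin q) → a ≢ b → Guaranteed 1 1 B →
                      (s t : Word q n) → 1 ≤ edit s t →
                      ∃ λ u → edit s u ≤ edit s t × edit t u ≤ 1 × B u
guaranteed-1-1-step a b a≢b G s t 1≤d =
  let i , i<n , replaceable = replaceable-position (toList s) (toList t)
                                (length-<-lev+length (toList s) (toList t) (length-toList-≡ s t) 1≤d)
      c′ , t′≢t = ∃-update-≢ a≢b (toList t) i i<n
      t′ = updateᵛ t i c′
      u , tu≤1 , t′u≤1 , u∈B = G t t′ (edit-updateᵛ≤1 t i c′)
      c , u≡t[i]≔c = hamming≤1-∩⇒update (toList t) (toList u) i c′ (length-toList-≡ t u)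
        (lev≤1⇒hamming≤1 (toList t) (toList u) (length-toList-≡ t u) tu≤1)
        (subst (λ z → hamming z (toList u) ≤ 1) (toList-updateᵛ t i c′)
          (lev≤1⇒hamming≤1 (toList t′) (toList u) (length-toList-≡ t′ u) t′u≤1))
        t′≢t
  in u , subst (λ z → lev (toList s) z ≤ edit s t) (sym u≡t[i]≔c) (replaceable c) , tu≤1 , u∈B

lemma8 : (q n : ℕ) → 2 ≤ q → 1 ≤ n → (B : Word q n → Set) →
         Guaranteed 1 1 B → (r : ℕ) → 1 ≤ r → Guaranteed r r B
lemma8 _ n (s≤s (s≤s _)) _ B G r 1≤r s t d≤r with ≤-total 1 (edit s t)
... | inj₁ 1≤d =
  let u , su≤d , tu≤1 , u∈B = guaranteed-1-1-step Fin.zero (Fin.suc Fin.zero) (λ ()) G s t 1≤d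
  in u , ≤-trans su≤d d≤r , ≤-trans tu≤1 1≤r , u∈B
... | inj₂ d≤1 =
  let u , su≤1 , tu≤1 , u∈B = G s t d≤1
  in u , ≤-trans su≤1 1≤r , ≤-trans tu≤1 1≤r , u∈B
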